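{- Suppose that every bridgeless cubic graph admits a Petersen coloring (the Petersen Coloring Conjecture). Then every bridgeless cubic graph $G$ satisfies $T(G)\leq \frac{|V(G)|}{10}$.
   Context: Graphs are finite and loopless but may have parallel edges. A cubic graph is one in which every vertex has degree $3$. For a vertex $v$ of a graph $G$, $\partial_G(v)$ denotes the set of edges incident to $v$. For cubic graphs $G,H$, an $H$-coloring of $G$ is a map $\phi:E(G)\to E(H)$ such that for every $v\in V(G)$ there is $w\in V(H)$ with $\phi(\partial_G(v))=\partial_H(w)$. A Petersen coloring of $G$ is a $P_{10}$-coloring of $G$, where $P_{10}$ is the Petersen graph. For a cubic graph $G$ and $U\subseteq V(G)$, $G_U$ denotes the cubic graph obtained from $G$ by expanding every vertex of $U$ into a triangle: a vertex $v$ with incident edges $e_1,e_2,e_3$ is replaced by three new mutually adjacent vertices $v_1,v_2,v_3$, with $e_i$ now incident to $v_i$ instead of $v$. For a bridgeless cubic graph $G$, $T(G)$ is the minimum size of a set $U\subseteq V(G)$ such that the edge set of $G_U$ is the union of four (not necessarily distinct) perfect matchings of $G_U$. -}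

module Defs where

open import Data.Nat using (ℕ; _+_)
open import Data.Fin using (Fin; #_)
open import Data.Fin.Properties using (_≟_)
open import Data.Bool using (Bool; true; false; if_then_else_)
open import Data.Vec using (lookup)
open import Data.List using (map; allFin)
open import Data.Nat.ListAction using (sum)
open import Data.Product using (Σ; ∃; _×_; _,_; proj₁; proj₂)
open import Data.Sum using (_⊎_)
open import Data.Empty using (⊥)
open import Relation.Nullary using (¬_)
open import Relation.Nullary.Decidable using (⌊_⌋)
open import Relation.Binary.PropositionalEquality using (_≡_; _≢_)
open import Data.Fin.Subset using (Subset)

record Multigraph (n m : ℕ) : Set where
  field
    ends : Fin m → Fin n × Fin n
open Multigraph public

module _ {n m : ℕ} (G : Multigraph n m) where

  Inc : Fin m → Fin n → Set
  Inc e v = proj₁ (ends G e) ≡ v ⊎ proj₂ (ends G e) ≡ v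

  Loopless : Set
  Loopless = ∀ e → proj₁ (ends G e) ≢ proj₂ (ends G e)

  degree : Fin n → ℕ
  degree v = sum (map (λ e → (if ⌊ proj₁ (ends G e) ≟ v ⌋ then 1 else 0)
                           + (if ⌊ proj₂ (ends G e) ≟ v ⌋ then 1 else 0))
                      (allFin m))

  Cubic : Set
  Cubic = ∀ v → degree v ≡ 3

  data ReachWithout (e : Fin m) : Fin n → Fin n → Set where
    here : ∀ {u} → ReachWithout e u u
    step : ∀ {u w v} (f : Fin m) → f ≢ e → Inc f u → Inc f w →
           ReachWithout e w v → ReachWithout e u v

  -- e is a bridge iff its endpoints are disconnected in G - e
  Bridgeless : Set
  Bridgeless = ∀ e → ReachWithout e (proj₁ (ends G e)) (proj₂ (ends G e))

-- The Petersen graph: outer 5-cycle 0..4, spokes i–(i+5), inner pentagram.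
petersen : Multigraph 10 15
ends petersen e = table e
  where
  table : Fin 15 → Fin 10 × Fin 10
  table Fin.zero = (# 0 , # 1)
  table (Fin.suc Fin.zero) = (# 1 , # 2)
  table (Fin.suc (Fin.suc Fin.zero)) = (# 2 , # 3)
  table (Fin.suc (Fin.suc (Fin.suc Fin.zero))) = (# 3 , # 4)
  table (Fin.suc (Fin.suc (Fin.suc (Fin.suc Fin.zero)))) = (# 4 , # 0)
  table (Fin.suc (Fin.suc (Fin.suc (Fin.suc (Fin.suc Fin.zero))))) = (# 0 , # 5)
  table (Fin.suc (Fin.suc (Fin.suc (Fin.suc (Fin.suc (Fin.suc Fin.zero)))))) = (# 1 , # 6)
  table (Fin.suc (Fin.suc (Fin.suc (Fin.suc (Fin.suc (Fin.suc (Fin.suc Fin.zero))))))) = (# 2 , # 7)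
  table (Fin.suc (Fin.suc (Fin.suc (Fin.suc (Fin.suc (Fin.suc (Fin.suc (Fin.suc Fin.zero)))))))) = (# 3 , # 8)
  table (Fin.suc (Fin.suc (Fin.suc (Fin.suc (Fin.suc (Fin.suc (Fin.suc (Fin.suc (Fin.suc Fin.zero))))))))) = (# 4 , # 9)
  table (Fin.suc (Fin.suc (Fin.suc (Fin.suc (Fin.suc (Fin.suc (Fin.suc (Fin.suc (Fin.suc (Fin.suc Fin.zero)))))))))) = (# 5 , # 7)
  table (Fin.suc (Fin.suc (Fin.suc (Fin.suc (Fin.suc (Fin.suc (Fin.suc (Fin.suc (Fin.suc (Fin.suc (Fin.suc Fin.zero))))))))))) = (# 7 , # 9)
  table (Fin.suc (Fin.suc (Fin.suc (Fin.suc (Fin.suc (Fin.suc (Fin.suc (Fin.suc (Fin.suc (Fin.suc (Fin.suc (Fin.suc Fin.zero)))))))))))) = (# 9 , # 6)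
  table (Fin.suc (Fin.suc (Fin.suc (Fin.suc (Fin.suc (Fin.suc (Fin.suc (Fin.suc (Fin.suc (Fin.suc (Fin.suc (Fin.suc (Fin.suc Fin.zero))))))))))))) = (# 6 , # 8)
  table (Fin.suc (Fin.suc (Fin.suc (Fin.suc (Fin.suc (Fin.suc (Fin.suc (Fin.suc (Fin.suc (Fin.suc (Fin.suc (Fin.suc (Fin.suc (Fin.suc Fin.zero)))))))))))))) = (# 8 , # 5)

-- H-coloring of G (H = target graph), as in the paper:
-- φ(∂_G(v)) = ∂_H(w) as sets of edges.
HColoring : ∀ {n m n' m'} → Multigraph n m → Multigraph n' m' → Set
HColoring {n} {m} {n'} {m'} G H =
  Σ (Fin m → Fin m') λ φ → ∀ (v : Fin n) → ∃ λ (w : Fin n') →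
    (∀ e → Inc G e v → Inc H (φ e) w) ×
    (∀ f → Inc H f w → ∃ λ e → Inc G e v × φ e ≡ f)

PetersenColoring : ∀ {n m} → Multigraph n m → Set
PetersenColoring G = HColoring G petersen

record IncStr : Set₁ where
  field
    Vt : Set
    Et : Set
    I  : Et → Vt → Set
open IncStr public

PerfectMatching : (S : IncStr) → (Et S → Bool) → Set
PerfectMatching S M = ∀ v → ∃ λ e → I S e v × M e ≡ true ×
                        (∀ e' → I S e' v → M e' ≡ true → e' ≡ e)

FourPMCover : IncStr → Set
FourPMCover S = Σ (Fin 4 → Et S → Bool) λ M →
  (∀ i → PerfectMatching S (M i)) × (∀ e → ∃ λ i → M i e ≡ true)

-- G_U: every vertex v ∈ U is replaced by a triangle.  The new vertex
-- v_i corresponding to the incident edge e_i is represented by the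
-- "dart" (edge-end) (e_i , side) at v.  The triangle edge v_j v_k is
-- represented by the dart of the opposite vertex v_i.
module _ {n m : ℕ} (G : Multigraph n m) (U : Subset n) where

  Dart : Set
  Dart = Fin m × Bool

  head : Dart → Fin n
  head (e , false) = proj₁ (ends G e)
  head (e , true)  = proj₂ (ends G e)

  ExpV : Set
  ExpV = (Σ (Fin n) λ v → lookup U v ≡ false) ⊎ (Σ Dart λ d → lookup U (head d) ≡ true)

  ExpE : Set
  ExpE = Fin m ⊎ (Σ Dart λ d → lookup U (head d) ≡ true)

  ExpI : ExpE → ExpV → Set
  ExpI (_⊎_.inj₁ e) (_⊎_.inj₁ (v , _)) = Inc G e v
  ExpI (_⊎_.inj₁ e) (_⊎_.inj₂ ((e' , _) , _)) = e' ≡ e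
  ExpI (_⊎_.inj₂ _) (_⊎_.inj₁ _) = ⊥
  ExpI (_⊎_.inj₂ (d , _)) (_⊎_.inj₂ (d' , _)) = head d' ≡ head d × ¬ (d' ≡ d)

  expand : IncStr
  expand = record { Vt = ExpV ; Et = ExpE ; I = ExpI }

module Submission where

-- A Petersen colouring φ of a cubic graph G maps the three edges at each vertex v
-- bijectively onto the three edges at a vertex π v of P₁₀: it is a local
-- isomorphism, and perfect matchings pull back along local isomorphisms.
-- Expanding a vertex w of P₁₀ into a triangle, and every vertex of U = π⁻¹(w)
-- likewise, φ lifts to a local isomorphism G_U → (P₁₀)_w.  For every w the graph
-- (P₁₀)_w is the union of four perfect matchings (verified by evaluation), hence
-- so is G_U; choosing w with the fewest preimages gives 10 |U| ≤ |V(G)|.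

open import Defs
open import Data.Nat using (ℕ; zero; suc; _+_; _*_; _≤_; _≤?_; _≡ᵇ_; z≤n; s≤s)
open import Data.Nat.Properties
  using (n≮n; ≤-refl; ≤-trans; <-≤-trans; <⇒≤; ≰⇒>; +-mono-≤; +-monoʳ-≤; *-monoʳ-≤; module ≤-Reasoning)
  renaming (+-0-commutativeMonoid to ℕ-+-commutativeMonoid)
open import Data.Nat.ListAction using () renaming (sum to sumˡ)
open import Data.Bool using (Bool; true; false; _∧_; if_then_else_)
open import Data.Bool.Properties using () renaming (_≟_ to _≟ᵇ_)
open import Data.Bool.ListAction using (any)
open import Data.Fin using (Fin; zero; suc; toℕ)
open import Data.Fin.Properties using (_≟_) renaming (all? to all-Fin?; any? to any-Fin?)
open import Data.Fin.Subset using (Subset; ⁅_⁆; ∣_∣; _∈_; _-_; _∩_; inside; outside)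
open import Data.Fin.Subset.Properties using (x∈p∧x≢y⇒x∈p-y; x∈p⇒∣p-x∣<∣p∣; ∣⁅x⁆∣≡1)
open import Data.List using (List; []; _∷_; length; allFin)
import Data.List as List
open import Data.List.Properties using (map-tabulate)
open import Data.List.Relation.Unary.All as All using (All; []; _∷_)
open import Data.List.Relation.Unary.Unique.Propositional using (Unique; []; _∷_)
open import Data.Vec using (Vec; lookup; tabulate; []; _∷_)
open import Data.Vec.Properties using (lookup∘tabulate; lookup-replicate; lookup⇒[]=)
open import Data.Product using (Σ; ∃; ∃₂; _×_; _,_; proj₁; proj₂)
open import Data.Product.Properties using () renaming (≡-dec to ×-≡-dec)
open import Data.Sum using (_⊎_; inj₁; inj₂)
open import Data.Sum.Properties using (inj₁-injective; inj₂-injective) renaming (≡-dec to ⊎-≡-dec)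
open import Data.Empty using (⊥-elim)
open import Function using (_∘_; id)
open import Relation.Nullary using (Dec; yes; no; ¬?; does; contradiction)
open import Relation.Nullary.Decidable using (⌊_⌋; map′; _×-dec_; _⊎-dec_; _→-dec_; from-yes; dec-true)
open import Relation.Binary.Definitions using (DecidableEquality)
open import Relation.Binary.PropositionalEquality using (_≡_; _≢_; refl; sym; trans; cong; subst; module ≡-Reasoning)
open import Axiom.UniquenessOfIdentityProofs using (module Decidable⇒UIP)
open import Algebra.Properties.CommutativeMonoid.Sum ℕ-+-commutativeMonoid using (sum; sum-syntax; sum-cong-≗; ∑-comm)

-- Sums and cardinalities

indicator : Bool → ℕ
indicator b = if b then 1 else 0

∣p∣≡∑ : ∀ {n} (p : Subset n) → ∣ p ∣ ≡ ∑[ i < n ] indicator (lookup p i)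
∣p∣≡∑ []            = refl
∣p∣≡∑ (inside ∷ p)  = cong suc (∣p∣≡∑ p)
∣p∣≡∑ (outside ∷ p) = ∣p∣≡∑ p

∑-mono-≤ : ∀ {n} {f g : Fin n → ℕ} → (∀ i → f i ≤ g i) → sum f ≤ sum g
∑-mono-≤ {zero}  f≤g = z≤n
∑-mono-≤ {suc n} f≤g = +-mono-≤ (f≤g zero) (∑-mono-≤ (f≤g ∘ suc))

∑-const-1 : ∀ n → ∑[ i < n ] 1 ≡ n
∑-const-1 zero    = refl
∑-const-1 (suc n) = cong suc (∑-const-1 n)

sumˡ-map-allFin : ∀ {m} (c : Fin m → ℕ) → sumˡ (List.map c (allFin m)) ≡ sum c
sumˡ-map-allFin c = trans (cong sumˡ (map-tabulate id c)) (sumˡ-tabulate c)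
  where
  sumˡ-tabulate : ∀ {m} (c : Fin m → ℕ) → sumˡ (List.tabulate c) ≡ sum c
  sumˡ-tabulate {zero}  c = refl
  sumˡ-tabulate {suc m} c = cong (c zero +_) (sumˡ-tabulate (c ∘ suc))

∃-below-average : ∀ {k} (c : Fin (suc k) → ℕ) → ∃ λ i → suc k * c i ≤ sum c
∃-below-average {zero}  c = zero , ≤-refl
∃-below-average {suc k} c with ∃-below-average (c ∘ suc)
... | i , k*ci≤∑ with c zero ≤? c (suc i)
...   | yes c₀≤ci = zero , +-monoʳ-≤ (c zero) (≤-trans (*-monoʳ-≤ (suc k) c₀≤ci) k*ci≤∑)
...   | no c₀≰ci  = suc i , +-mono-≤ (<⇒≤ (≰⇒> c₀≰ci)) k*ci≤∑

Unique⇒length≤∣p∣ : ∀ {n} {p : Subset n} {xs} → Unique xs → All (_∈ p) xs → length xs ≤ ∣ p ∣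
Unique⇒length≤∣p∣ []                 []           = z≤n
Unique⇒length≤∣p∣ {p = p} {x ∷ xs} (x≢xs ∷ unique-xs) (x∈p ∷ xs⊆p) =
  <-≤-trans (s≤s (Unique⇒length≤∣p∣ unique-xs xs⊆p-x)) (x∈p⇒∣p-x∣<∣p∣ x∈p)
  where
  xs⊆p-x : All (_∈ p - x) xs
  xs⊆p-x = All.zipWith (λ (y∈p , x≢y) → x∈p∧x≢y⇒x∈p-y y∈p (x≢y ∘ sym)) (xs⊆p , x≢xs)

preimage : ∀ {n k} → (Fin n → Fin k) → Subset k → Subset n
preimage π W = tabulate (lookup W ∘ π)

⁅⁆-sym : ∀ {k} (w x : Fin k) → lookup ⁅ w ⁆ x ≡ lookup ⁅ x ⁆ w
⁅⁆-sym zero    zero    = refl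
⁅⁆-sym zero    (suc x) = lookup-replicate x outside
⁅⁆-sym (suc w) zero    = sym (lookup-replicate w outside)
⁅⁆-sym (suc w) (suc x) = ⁅⁆-sym w x

∑-∣fibre∣ : ∀ {n k} (π : Fin n → Fin k) → ∑[ w < k ] ∣ preimage π ⁅ w ⁆ ∣ ≡ n
∑-∣fibre∣ {n} {k} π = begin
  ∑[ w < k ] ∣ preimage π ⁅ w ⁆ ∣
    ≡⟨ sum-cong-≗ (∣p∣≡∑ ∘ preimage π ∘ ⁅_⁆) ⟩
  ∑[ w < k ] ∑[ v < n ] indicator (lookup (preimage π ⁅ w ⁆) v)
    ≡⟨ sum-cong-≗ (λ w → sum-cong-≗ (cong indicator ∘ lookup∘tabulate (lookup ⁅ w ⁆ ∘ π))) ⟩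
  ∑[ w < k ] ∑[ v < n ] indicator (lookup ⁅ w ⁆ (π v))
    ≡⟨ ∑-comm (λ w v → indicator (lookup ⁅ w ⁆ (π v))) ⟩
  ∑[ v < n ] ∑[ w < k ] indicator (lookup ⁅ w ⁆ (π v))
    ≡⟨ sum-cong-≗ (∑-singleton ∘ π) ⟩
  ∑[ v < n ] 1
    ≡⟨ ∑-const-1 n ⟩
  n ∎
  where
  open ≡-Reasoning
  ∑-singleton : ∀ x → ∑[ w < k ] indicator (lookup ⁅ w ⁆ x) ≡ 1
  ∑-singleton x = begin
    ∑[ w < k ] indicator (lookup ⁅ w ⁆ x)   ≡⟨ sum-cong-≗ (λ w → cong indicator (⁅⁆-sym w x)) ⟩
    ∑[ w < k ] indicator (lookup ⁅ x ⁆ w)   ≡⟨ ∣p∣≡∑ ⁅ x ⁆ ⟨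
    ∣ ⁅ x ⁆ ∣                                ≡⟨ ∣⁅x⁆∣≡1 x ⟩
    1                                        ∎

small-fibre : ∀ {n k} (π : Fin n → Fin (suc k)) → ∃ λ w → suc k * ∣ preimage π ⁅ w ⁆ ∣ ≤ n
small-fibre {k = k} π with ∃-below-average (λ w → ∣ preimage π ⁅ w ⁆ ∣)
... | w , below = w , subst (suc k * ∣ preimage π ⁅ w ⁆ ∣ ≤_) (∑-∣fibre∣ π) below

-- Stars and degrees

module _ {n m} (G : Multigraph n m) where

  Inc? : ∀ e v → Dec (Inc G e v)
  Inc? e v = (proj₁ (ends G e) ≟ v) ⊎-dec (proj₂ (ends G e) ≟ v)

  star : Fin n → Subset m
  star v = tabulate (λ e → does (Inc? e v))

  ∈-star : ∀ {e v} → Inc G e v → e ∈ star v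
  ∈-star {e} {v} e∼v = lookup⇒[]= e (star v) (trans (lookup∘tabulate _ e) (dec-true (Inc? e v) e∼v))

  ends-at : Fin n → Fin m → ℕ
  ends-at v e = (if ⌊ proj₁ (ends G e) ≟ v ⌋ then 1 else 0) + (if ⌊ proj₂ (ends G e) ≟ v ⌋ then 1 else 0)

  ∣star∣≤degree : ∀ v → ∣ star v ∣ ≤ degree G v
  ∣star∣≤degree v = begin
    ∣ star v ∣                                 ≡⟨ ∣p∣≡∑ (star v) ⟩
    ∑[ e < m ] indicator (lookup (star v) e)   ≡⟨ sum-cong-≗ (cong indicator ∘ lookup∘tabulate (λ e → does (Inc? e v))) ⟩
    ∑[ e < m ] indicator (does (Inc? e v))     ≤⟨ ∑-mono-≤ indicator≤ends-at ⟩
    ∑[ e < m ] ends-at v e                     ≡⟨ sumˡ-map-allFin (ends-at v) ⟨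
    degree G v                                 ∎
    where
    open ≤-Reasoning
    indicator≤ends-at : ∀ e → indicator (does (Inc? e v)) ≤ ends-at v e
    indicator≤ends-at e with proj₁ (ends G e) ≟ v | proj₂ (ends G e) ≟ v
    ... | yes _ | _     = s≤s z≤n
    ... | no _  | yes _ = ≤-refl
    ... | no _  | no _  = z≤n

  Unique⇒length≤degree : ∀ {v es} → Unique es → All (λ e → Inc G e v) es → length es ≤ degree G v
  Unique⇒length≤degree {v} unique es∼v =
    ≤-trans (Unique⇒length≤∣p∣ unique (All.map ∈-star es∼v)) (∣star∣≤degree v)

TwoSiblings : ∀ {n m} → Multigraph n m → Set
TwoSiblings H = ∀ {f w} → Inc H f w → ∃₂ λ g h → Inc H g w × Inc H h w × f ≢ g × f ≢ h × g ≢ h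

module _ {n m n′ m′} {G : Multigraph n m} {H : Multigraph n′ m′} (φ : Fin m → Fin m′) {v w}
         (v-cubic : degree G v ≡ 3) (siblings : TwoSiblings H)
         (preserves : ∀ {e} → Inc G e v → Inc H (φ e) w)
         (onto : ∀ {f} → Inc H f w → ∃ λ e → Inc G e v × φ e ≡ f) where

  private
    apart : ∀ {a b x y} → φ a ≡ x → φ b ≡ y → x ≢ y → a ≢ b
    apart refl refl x≢y refl = x≢y refl

  -- Two distinct edges at v of the same colour, together with lifts of the
  -- two other edges at w, would be four distinct edges at v.
  star-injective : ∀ {e e′} → Inc G e v → Inc G e′ v → φ e ≡ φ e′ → e ≡ e′
  star-injective {e} {e′} e∼v e′∼v φe≡φe′ with e ≟ e′
  ... | yes e≡e′ = e≡e′
  ... | no e≢e′ with siblings (preserves e∼v)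
  ...   | g , h , g∼w , h∼w , φe≢g , φe≢h , g≢h with onto g∼w | onto h∼w
  ...     | eg , eg∼v , φeg≡g | eh , eh∼v , φeh≡h =
    contradiction (subst (4 ≤_) v-cubic (Unique⇒length≤degree G unique incident)) (n≮n 3)
    where
    unique : Unique (e ∷ e′ ∷ eg ∷ eh ∷ [])
    unique = (e≢e′ ∷ apart refl φeg≡g φe≢g ∷ apart refl φeh≡h φe≢h ∷ [])
           ∷ (apart (sym φe≡φe′) φeg≡g φe≢g ∷ apart (sym φe≡φe′) φeh≡h φe≢h ∷ [])
           ∷ (apart φeg≡g φeh≡h g≢h ∷ [])
           ∷ [] ∷ []
    incident : All (λ x → Inc G x v) (e ∷ e′ ∷ eg ∷ eh ∷ [])
    incident = e∼v ∷ e′∼v ∷ eg∼v ∷ eh∼v ∷ []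

-- Local isomorphisms

incidence : ∀ {n m} → Multigraph n m → IncStr
incidence {n} {m} G = record { Vt = Fin n ; Et = Fin m ; I = Inc G }

record LocalIso (S T : IncStr) : Set where
  field
    edge      : Et S → Et T
    vertex    : Vt S → Vt T
    preserves : ∀ {e v} → I S e v → I T (edge e) (vertex v)
    onto      : ∀ {v f} → I T f (vertex v) → ∃ λ e → I S e v × edge e ≡ f
    injective : ∀ {v e e′} → I S e v → I S e′ v → edge e ≡ edge e′ → e ≡ e′

coloring⇒LocalIso : ∀ {n m n′ m′} {G : Multigraph n m} {H : Multigraph n′ m′} →
                    Cubic G → TwoSiblings H → HColoring G H → LocalIso (incidence G) (incidence H)
coloring⇒LocalIso {n = n} {n′ = n′} {G = G} {H = H} cubic siblings (φ , colour) = record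
  { edge      = φ
  ; vertex    = π
  ; preserves = preserves
  ; onto      = onto
  ; injective = λ {v} → star-injective φ (cubic v) siblings preserves onto
  }
  where
  π : Fin n → Fin n′
  π v = proj₁ (colour v)

  preserves : ∀ {e v} → Inc G e v → Inc H (φ e) (π v)
  preserves {e} {v} = proj₁ (proj₂ (colour v)) e

  onto : ∀ {v f} → Inc H f (π v) → ∃ λ e → Inc G e v × φ e ≡ f
  onto {v} {f} = proj₂ (proj₂ (colour v)) f

module _ {S T : IncStr} (ι : LocalIso S T) where
  open LocalIso ι

  pullback-PerfectMatching : ∀ {M} → PerfectMatching T M → PerfectMatching S (M ∘ edge)
  pullback-PerfectMatching matching v with matching (vertex v)
  ... | f , f∼v , Mf , unique with onto f∼v
  ...   | e , e∼v , refl =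
    e , e∼v , Mf , λ e′ e′∼v Me′ → injective e′∼v e∼v (unique (edge e′) (preserves e′∼v) Me′)

  pullback-FourPMCover : FourPMCover T → FourPMCover S
  pullback-FourPMCover (M , matchings , covers) =
    (λ i → M i ∘ edge) , pullback-PerfectMatching ∘ matchings , covers ∘ edge

-- Expansions

module _ {n m} (G : Multigraph n m) (U : Subset n) where

  head-Inc : ∀ d → Inc G (proj₁ d) (head G U d)
  head-Inc (e , false) = inj₁ refl
  head-Inc (e , true)  = inj₂ refl

  dartAt : ∀ {e v} → Inc G e v → Σ Bool λ s → head G U (e , s) ≡ v
  dartAt (inj₁ p) = false , p
  dartAt (inj₂ p) = true , p

  dart-≡ : Loopless G → ∀ {e e′ s s′} → e ≡ e′ → head G U (e , s) ≡ head G U (e′ , s′) → (e , s) ≡ (e′ , s′)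
  dart-≡ loopless {e} {s = false} {false} refl _ = refl
  dart-≡ loopless {e} {s = false} {true}  refl p = ⊥-elim (loopless e p)
  dart-≡ loopless {e} {s = true}  {false} refl p = ⊥-elim (loopless e (sym p))
  dart-≡ loopless {e} {s = true}  {true}  refl _ = refl

TriangleDart : ∀ {n m} → Multigraph n m → Subset n → Set
TriangleDart G U = Σ (Dart G U) λ d → lookup U (head G U d) ≡ true

≡-by-witness : ∀ {A : Set} {t : A → Bool} {b a a′} {p : t a ≡ b} {p′ : t a′ ≡ b} →
               a ≡ a′ → _≡_ {A = Σ A λ x → t x ≡ b} (a , p) (a′ , p′)
≡-by-witness refl = cong (_ ,_) (≡-irrelevant _ _)
  where open Decidable⇒UIP _≟ᵇ_

module _ {n m n′ m′} {G : Multigraph n m} {H : Multigraph n′ m′}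
         (G-loopless : Loopless G) (H-loopless : Loopless H)
         (ι : LocalIso (incidence G) (incidence H)) (W : Subset n′) where

  open LocalIso ι renaming (edge to φ; vertex to π)

  private
    U : Subset n
    U = preimage π W

    headᴳ : Dart G U → Fin n
    headᴳ = head G U

    headᴴ : Dart H W → Fin n′
    headᴴ = head H W

    lookup-U : ∀ {v b} → lookup U v ≡ b → lookup W (π v) ≡ b
    lookup-U {v} = trans (sym (lookup∘tabulate (lookup W ∘ π) v))

    dart⁺ : Dart G U → Dart H W
    dart⁺ (e , s) = φ e , proj₁ (dartAt H W (preserves (head-Inc G U (e , s))))

    head-dart⁺ : ∀ d → headᴴ (dart⁺ d) ≡ π (headᴳ d)
    head-dart⁺ (e , s) = proj₂ (dartAt H W (preserves (head-Inc G U (e , s))))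

    dart⁺-injective : ∀ {d d′} → headᴳ d ≡ headᴳ d′ → dart⁺ d ≡ dart⁺ d′ → d ≡ d′
    dart⁺-injective {e , s} {e′ , s′} same-head same-image = dart-≡ G U G-loopless
      (injective (head-Inc G U (e , s)) (subst (Inc G e′) (sym same-head) (head-Inc G U (e′ , s′)))
                 (cong proj₁ same-image))
      same-head

    dart⁺-≡ : ∀ d {d′} → φ (proj₁ d) ≡ proj₁ d′ → headᴴ d′ ≡ π (headᴳ d) → dart⁺ d ≡ d′
    dart⁺-≡ d φe≡f same-head = dart-≡ H W H-loopless φe≡f (trans (head-dart⁺ d) (sym same-head))

    triangle⁺ : TriangleDart G U → TriangleDart H W
    triangle⁺ (d , d∈U) = dart⁺ d , subst (λ x → lookup W x ≡ true) (sym (head-dart⁺ d)) (lookup-U d∈U)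

    vertex⁺ : ExpV G U → ExpV H W
    vertex⁺ (inj₁ (v , v∉U)) = inj₁ (π v , lookup-U v∉U)
    vertex⁺ (inj₂ t)         = inj₂ (triangle⁺ t)

    edge⁺ : ExpE G U → ExpE H W
    edge⁺ (inj₁ e) = inj₁ (φ e)
    edge⁺ (inj₂ t) = inj₂ (triangle⁺ t)

    preserves⁺ : ∀ {E x} → ExpI G U E x → ExpI H W (edge⁺ E) (vertex⁺ x)
    preserves⁺ {inj₁ e} {inj₁ _}               e∼v  = preserves e∼v
    preserves⁺ {inj₁ e} {inj₂ _}               refl = refl
    preserves⁺ {inj₂ (d , _)} {inj₂ (d′ , _)} (same-head , d′≢d) =
      trans (head-dart⁺ d′) (trans (cong π same-head) (sym (head-dart⁺ d))) , d′≢d ∘ dart⁺-injective same-head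

    onto⁺ : ∀ {x F} → ExpI H W F (vertex⁺ x) → ∃ λ E → ExpI G U E x × edge⁺ E ≡ F
    onto⁺ {inj₁ _} {inj₁ _} f∼πv with onto f∼πv
    ... | e , e∼v , refl = inj₁ e , e∼v , refl
    onto⁺ {inj₂ ((e , _) , _)} {inj₁ _} refl = inj₁ e , refl , refl
    onto⁺ {inj₂ (d , d∈U)} {inj₂ (d′ , _)} (same-head , d⁺≢d′) with onto f∼πv
      where
      f∼πv : Inc H (proj₁ d′) (π (headᴳ d))
      f∼πv = subst (Inc H (proj₁ d′)) (trans (sym same-head) (head-dart⁺ d)) (head-Inc H W d′)
    ... | e″ , e″∼v , φe″≡f with dartAt G U e″∼v
    ...   | s″ , head≡v = inj₂ ((e″ , s″) , subst (λ x → lookup U x ≡ true) (sym head≡v) d∈U)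
                        , (sym head≡v , λ d≡d″ → d⁺≢d′ (trans (cong dart⁺ d≡d″) image))
                        , cong inj₂ (≡-by-witness image)
      where
      image : dart⁺ (e″ , s″) ≡ d′
      image = dart⁺-≡ (e″ , s″) φe″≡f (trans (sym same-head) (trans (head-dart⁺ d) (cong π (sym head≡v))))

    injective⁺ : ∀ {x E E′} → ExpI G U E x → ExpI G U E′ x → edge⁺ E ≡ edge⁺ E′ → E ≡ E′
    injective⁺ {inj₁ _} {inj₁ _} {inj₁ _} e∼v e′∼v same = cong inj₁ (injective e∼v e′∼v (inj₁-injective same))
    injective⁺ {inj₂ _} {inj₁ _} {inj₁ _} refl refl _ = refl
    injective⁺ {inj₂ _} {inj₂ _} {inj₂ _} (d₁-at-d , _) (d₂-at-d , _) same =
      cong inj₂ (≡-by-witness (dart⁺-injective (trans (sym d₁-at-d) d₂-at-d) (cong proj₁ (inj₂-injective same))))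

  expand-LocalIso : LocalIso (expand G U) (expand H W)
  expand-LocalIso = record
    { edge = edge⁺ ; vertex = vertex⁺ ; preserves = preserves⁺ ; onto = onto⁺ ; injective = injective⁺ }

-- Deciding perfect matchings of expansions

record Exhaustible (A : Set) : Set₁ where
  field
    all? : ∀ {P : A → Set} → (∀ a → Dec (P a)) → Dec (∀ a → P a)
    any? : ∀ {P : A → Set} → (∀ a → Dec (P a)) → Dec (∃ P)
open Exhaustible

Fin-exhaustible : ∀ {k} → Exhaustible (Fin k)
all? Fin-exhaustible = all-Fin?
any? Fin-exhaustible = any-Fin?

Bool-exhaustible : Exhaustible Bool
all? Bool-exhaustible P? = map′ (λ (Pf , Pt) → λ { false → Pf ; true → Pt }) (λ ∀P → ∀P false , ∀P true)
                                (P? false ×-dec P? true)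
any? Bool-exhaustible P? = map′ (λ { (inj₁ Pf) → false , Pf ; (inj₂ Pt) → true , Pt })
                                (λ { (false , Pf) → inj₁ Pf ; (true , Pt) → inj₂ Pt })
                                (P? false ⊎-dec P? true)

×-exhaustible : ∀ {A B} → Exhaustible A → Exhaustible B → Exhaustible (A × B)
all? (×-exhaustible 𝔸 𝔹) P? = map′ (λ ∀P (a , b) → ∀P a b) (λ ∀P a b → ∀P (a , b))
                                   (all? 𝔸 λ a → all? 𝔹 λ b → P? (a , b))
any? (×-exhaustible 𝔸 𝔹) P? = map′ (λ (a , b , Pab) → (a , b) , Pab) (λ ((a , b) , Pab) → a , b , Pab)
                                   (any? 𝔸 λ a → any? 𝔹 λ b → P? (a , b))

⊎-exhaustible : ∀ {A B} → Exhaustible A → Exhaustible B → Exhaustible (A ⊎ B)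
all? (⊎-exhaustible 𝔸 𝔹) P? = map′ (λ (∀P₁ , ∀P₂) → λ { (inj₁ a) → ∀P₁ a ; (inj₂ b) → ∀P₂ b })
                                   (λ ∀P → ∀P ∘ inj₁ , ∀P ∘ inj₂)
                                   (all? 𝔸 (P? ∘ inj₁) ×-dec all? 𝔹 (P? ∘ inj₂))
any? (⊎-exhaustible 𝔸 𝔹) P? = map′ (λ { (inj₁ (a , Pa)) → inj₁ a , Pa ; (inj₂ (b , Pb)) → inj₂ b , Pb })
                                   (λ { (inj₁ a , Pa) → inj₁ (a , Pa) ; (inj₂ b , Pb) → inj₂ (b , Pb) })
                                   (any? 𝔸 (P? ∘ inj₁) ⊎-dec any? 𝔹 (P? ∘ inj₂))

Σ≡-exhaustible : ∀ {A} (t : A → Bool) b → Exhaustible A → Exhaustible (Σ A λ a → t a ≡ b)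
all? (Σ≡-exhaustible t b 𝔸) {P} P? = map′ (λ ∀P (a , p) → ∀P a p) (λ ∀P a p → ∀P (a , p)) (all? 𝔸 all-proofs?)
  where
  all-proofs? : ∀ a → Dec (∀ p → P (a , p))
  all-proofs? a with t a ≟ᵇ b
  ... | yes p = map′ (λ Pp q → subst P (≡-by-witness refl) Pp) (λ ∀p → ∀p p) (P? (a , p))
  ... | no ¬p = yes (⊥-elim ∘ ¬p)
any? (Σ≡-exhaustible t b 𝔸) {P} P? = map′ (λ (a , p , Pp) → (a , p) , Pp) (λ ((a , p) , Pp) → a , p , Pp)
                                          (any? 𝔸 some-proof?)
  where
  some-proof? : ∀ a → Dec (∃ λ p → P (a , p))
  some-proof? a with t a ≟ᵇ b
  ... | yes p = map′ (p ,_) (λ (q , Pq) → subst P (≡-by-witness refl) Pq) (P? (a , p))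
  ... | no ¬p = no (¬p ∘ proj₁)

module _ {n m} (H : Multigraph n m) (W : Subset n) where

  private
    _≟dart_ : DecidableEquality (Dart H W)
    _≟dart_ = ×-≡-dec _≟_ _≟ᵇ_

    _≟E_ : DecidableEquality (ExpE H W)
    _≟E_ = ⊎-≡-dec _≟_ λ (d , _) (d′ , _) → map′ ≡-by-witness (cong proj₁) (d ≟dart d′)

    TriangleDart-exhaustible : Exhaustible (TriangleDart H W)
    TriangleDart-exhaustible = Σ≡-exhaustible (lookup W ∘ head H W) true (×-exhaustible Fin-exhaustible Bool-exhaustible)

    ExpV-exhaustible : Exhaustible (ExpV H W)
    ExpV-exhaustible = ⊎-exhaustible (Σ≡-exhaustible (lookup W) false Fin-exhaustible) TriangleDart-exhaustible

    ExpE-exhaustible : Exhaustible (ExpE H W)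
    ExpE-exhaustible = ⊎-exhaustible Fin-exhaustible TriangleDart-exhaustible

    ExpI? : ∀ E x → Dec (ExpI H W E x)
    ExpI? (inj₁ f)       (inj₁ (v , _))        = Inc? H f v
    ExpI? (inj₁ f)       (inj₂ ((f′ , _) , _)) = f′ ≟ f
    ExpI? (inj₂ _)       (inj₁ _)              = no λ ()
    ExpI? (inj₂ (d , _)) (inj₂ (d′ , _))       = (head H W d′ ≟ head H W d) ×-dec ¬? (d′ ≟dart d)

  perfectMatching? : ∀ M → Dec (PerfectMatching (expand H W) M)
  perfectMatching? M = all? ExpV-exhaustible λ x → any? ExpE-exhaustible λ E →
    ExpI? E x ×-dec (M E ≟ᵇ true) ×-dec
    all? ExpE-exhaustible λ E′ → ExpI? E′ x →-dec ((M E′ ≟ᵇ true) →-dec (E′ ≟E E))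

  covers? : (M : Fin 4 → ExpE H W → Bool) →
            Dec ((∀ i → PerfectMatching (expand H W) (M i)) × (∀ E → ∃ λ i → M i E ≡ true))
  covers? M = all-Fin? (perfectMatching? ∘ M) ×-dec all? ExpE-exhaustible λ E → any-Fin? λ i → M i E ≟ᵇ true

  -- A perfect matching of the expansion is determined by its set N of original
  -- edges, which meets every vertex outside W once and every w ∈ W once or
  -- three times.  In the first case the other two triangle vertices at w are
  -- matched by the triangle edge opposite the end of the N-edge, and that
  -- triangle edge is represented by the very same dart.
  inflate : Subset m → ExpE H W → Bool
  inflate N (inj₁ f)             = lookup N f
  inflate N (inj₂ ((f , s) , _)) = lookup N f ∧ (∣ N ∩ star H (head H W (f , s)) ∣ ≡ᵇ 1)

-- The Petersen graph

petersen-loopless : Loopless petersen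
petersen-loopless = from-yes (all-Fin? λ e → ¬? (proj₁ (ends petersen e) ≟ proj₂ (ends petersen e)))

petersen-twoSiblings : TwoSiblings petersen
petersen-twoSiblings {f} {w} = from-yes (all-Fin? λ f → all-Fin? λ w → Inc? petersen f w →-dec
  any-Fin? λ g → any-Fin? λ h →
    Inc? petersen g w ×-dec Inc? petersen h w ×-dec ¬? (f ≟ g) ×-dec ¬? (f ≟ h) ×-dec ¬? (g ≟ h)) f w

edgeSet : ∀ {m} → List ℕ → Subset m
edgeSet ks = tabulate λ f → any (toℕ f ≡ᵇ_) ks

-- Row w lists, by edge number in petersen, three perfect matchings of P₁₀
-- meeting w in distinct edges, and an edge set meeting w three times and
-- every other vertex once that contains the edges the three matchings miss.
petersen-covers : Vec (Vec (List ℕ) 4) 10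
petersen-covers =
  ((0 ∷ 2 ∷ 9 ∷ 10 ∷ 13 ∷ []) ∷ (1 ∷ 3 ∷ 5 ∷ 11 ∷ 13 ∷ []) ∷ (2 ∷ 4 ∷ 6 ∷ 11 ∷ 14 ∷ []) ∷ (0 ∷ 4 ∷ 5 ∷ 7 ∷ 8 ∷ 12 ∷ []) ∷ []) ∷
  ((0 ∷ 2 ∷ 9 ∷ 10 ∷ 13 ∷ []) ∷ (1 ∷ 4 ∷ 8 ∷ 10 ∷ 12 ∷ []) ∷ (5 ∷ 6 ∷ 7 ∷ 8 ∷ 9 ∷ [])    ∷ (0 ∷ 1 ∷ 3 ∷ 6 ∷ 11 ∷ 14 ∷ []) ∷ []) ∷
  ((0 ∷ 2 ∷ 9 ∷ 10 ∷ 13 ∷ []) ∷ (1 ∷ 3 ∷ 5 ∷ 11 ∷ 13 ∷ []) ∷ (5 ∷ 6 ∷ 7 ∷ 8 ∷ 9 ∷ [])    ∷ (1 ∷ 2 ∷ 4 ∷ 7 ∷ 12 ∷ 14 ∷ []) ∷ []) ∷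
  ((0 ∷ 2 ∷ 9 ∷ 10 ∷ 13 ∷ []) ∷ (0 ∷ 3 ∷ 7 ∷ 12 ∷ 14 ∷ []) ∷ (1 ∷ 4 ∷ 8 ∷ 10 ∷ 12 ∷ []) ∷ (2 ∷ 3 ∷ 5 ∷ 6 ∷ 8 ∷ 11 ∷ []) ∷ []) ∷
  ((0 ∷ 2 ∷ 9 ∷ 10 ∷ 13 ∷ []) ∷ (1 ∷ 3 ∷ 5 ∷ 11 ∷ 13 ∷ []) ∷ (1 ∷ 4 ∷ 8 ∷ 10 ∷ 12 ∷ []) ∷ (3 ∷ 4 ∷ 6 ∷ 7 ∷ 9 ∷ 14 ∷ []) ∷ []) ∷
  ((0 ∷ 2 ∷ 9 ∷ 10 ∷ 13 ∷ []) ∷ (2 ∷ 4 ∷ 6 ∷ 11 ∷ 14 ∷ []) ∷ (5 ∷ 6 ∷ 7 ∷ 8 ∷ 9 ∷ [])    ∷ (1 ∷ 3 ∷ 5 ∷ 10 ∷ 12 ∷ 14 ∷ []) ∷ []) ∷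
  ((0 ∷ 2 ∷ 9 ∷ 10 ∷ 13 ∷ []) ∷ (1 ∷ 4 ∷ 8 ∷ 10 ∷ 12 ∷ []) ∷ (2 ∷ 4 ∷ 6 ∷ 11 ∷ 14 ∷ []) ∷ (3 ∷ 5 ∷ 6 ∷ 7 ∷ 12 ∷ 13 ∷ []) ∷ []) ∷
  ((0 ∷ 2 ∷ 9 ∷ 10 ∷ 13 ∷ []) ∷ (0 ∷ 3 ∷ 7 ∷ 12 ∷ 14 ∷ []) ∷ (1 ∷ 3 ∷ 5 ∷ 11 ∷ 13 ∷ []) ∷ (4 ∷ 6 ∷ 7 ∷ 8 ∷ 10 ∷ 11 ∷ []) ∷ []) ∷
  ((0 ∷ 2 ∷ 9 ∷ 10 ∷ 13 ∷ []) ∷ (0 ∷ 3 ∷ 7 ∷ 12 ∷ 14 ∷ []) ∷ (5 ∷ 6 ∷ 7 ∷ 8 ∷ 9 ∷ [])    ∷ (1 ∷ 4 ∷ 8 ∷ 11 ∷ 13 ∷ 14 ∷ []) ∷ []) ∷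
  ((0 ∷ 2 ∷ 9 ∷ 10 ∷ 13 ∷ []) ∷ (0 ∷ 3 ∷ 7 ∷ 12 ∷ 14 ∷ []) ∷ (2 ∷ 4 ∷ 6 ∷ 11 ∷ 14 ∷ []) ∷ (1 ∷ 5 ∷ 8 ∷ 9 ∷ 11 ∷ 12 ∷ []) ∷ []) ∷
  []

expanded-petersen-FourPMCover : ∀ w → FourPMCover (expand petersen ⁅ w ⁆)
expanded-petersen-FourPMCover w = matchings w , from-yes (all-Fin? λ w → covers? petersen ⁅ w ⁆ (matchings w)) w
  where
  matchings : ∀ w → Fin 4 → ExpE petersen ⁅ w ⁆ → Bool
  matchings w i = inflate petersen ⁅ w ⁆ (edgeSet (lookup (lookup petersen-covers w) i))

corollary3p6 : (∀ {n m} (G : Multigraph n m) → Loopless G → Cubic G → Bridgeless G → PetersenColoring G) →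
               ∀ {n m} (G : Multigraph n m) → Loopless G → Cubic G → Bridgeless G →
               Σ (Subset n) λ U → 10 * ∣ U ∣ ≤ n × FourPMCover (expand G U)
corollary3p6 petersen-coloring {n} G loopless cubic bridgeless =
  preimage π ⁅ w ⁆ , proj₂ sparse-fibre ,
  pullback-FourPMCover (expand-LocalIso loopless petersen-loopless ι ⁅ w ⁆) (expanded-petersen-FourPMCover w)
  where
  ι : LocalIso (incidence G) (incidence petersen)
  ι = coloring⇒LocalIso cubic petersen-twoSiblings (petersen-coloring G loopless cubic bridgeless)

  π : Fin n → Fin 10
  π = LocalIso.vertex ι

  sparse-fibre : ∃ λ w → 10 * ∣ preimage π ⁅ w ⁆ ∣ ≤ n
  sparse-fibre = small-fibre π

  w : Fin 10
  w = proj₁ sparse-fibre
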